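{- If $M$ is a matroid with no loops, then the tipless baseless $1$-cone $Q_1(M)\setminus(E\cup\{a\})$ of $M$ is isomorphic to the Higgs lift $L(M)$ of $M$.
   Context: The Higgs lift of a matroid $M=(E,r)$ is the matroid $L(M)$ on $E$ with rank function $r_L(X)=\min\{r(X)+1,|X|\}$. Cyclic set: $X$ with $M|X$ having no coloops; cyclic flat: a flat that is cyclic; $\mathcal{Z}(M)$: the set of cyclic flats. Free $m$-cone: let $M=(E,r)$ be loopless and $m\geq1$. For each $e\in E$ let $T_e$ be a set of $m$ new elements (pairwise disjoint, disjoint from $E$), $T=\bigcup_e T_e$, and $a$ a further new element (the tip); $E(Q)=E\cup T\cup\{a\}$. For $S\subseteq E$ let $q(S)=S\cup\{a\}\cup\bigcup_{e\in S}T_e$. The free $m$-cone $Q_m(M)$ is the unique matroid on $E(Q)$ whose cyclic flats are exactly the sets in $\mathcal{Z}(M)\cup\{q(F):F\text{ a nonempty flat of }M\}$, with rank $r(Z)$ on $Z\in\mathcal{Z}(M)$ and rank $r(F)+1$ on $q(F)$. The tipless baseless $m$-cone is the deletion $Q_m(M)\setminus(E\cup\{a\})$, a matroid on $T$. -}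

module Defs where

open import Data.Nat using (ℕ; suc; _+_; _≤_; _<_; _⊓_)
open import Data.Bool using (true; false)
open import Data.Fin using (Fin)
open import Data.Fin.Subset using (Subset; ⊥; ⁅_⁆; _∈_; _∉_; _⊆_; _∪_; _∩_; _-_; ∣_∣; Nonempty)
open import Data.Fin.Permutation using (Permutation′; _⟨$⟩ˡ_)
open import Data.Vec using (Vec; _∷_; []; _++_; tabulate; lookup)
open import Data.Product using (Σ; _×_; _,_)
open import Data.Sum using (_⊎_)
open import Relation.Binary.PropositionalEquality using (_≡_)
open import Function.Bundles using (_⇔_)

-- A matroid on the ground set Fin n, given by its rank function
-- (rank axioms R1-R3; nonnegativity is automatic in ℕ).
record Matroid (n : ℕ) : Set where
  field
    rank     : Subset n → ℕ
    r-bound  : ∀ X → rank X ≤ ∣ X ∣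
    r-mono   : ∀ {X Y} → X ⊆ Y → rank X ≤ rank Y
    r-submod : ∀ X Y → rank (X ∪ Y) + rank (X ∩ Y) ≤ rank X + rank Y
open Matroid public

module _ {n : ℕ} (M : Matroid n) where
  Loopless : Set
  Loopless = ∀ (e : Fin n) → rank M ⁅ e ⁆ ≡ 1

  IsFlat : Subset n → Set
  IsFlat X = ∀ e → e ∉ X → rank M X < rank M (X ∪ ⁅ e ⁆)

  -- X is cyclic: M|X has no coloops, i.e. removing any e ∈ X keeps the rank
  IsCyclic : Subset n → Set
  IsCyclic X = ∀ e → e ∈ X → rank M (X - e) ≡ rank M X

  IsCyclicFlat : Subset n → Set
  IsCyclicFlat X = IsCyclic X × IsFlat X

  higgsRank : Subset n → ℕ
  higgsRank X = suc (rank M X) ⊓ ∣ X ∣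

-- Ground set of the free 1-cone over Fin n, encoded as Fin (n + (n + 1)):
-- first block = E, second block = T (t_e is the copy of e, T_e = {t_e}),
-- last element = tip a.
ConeSize : ℕ → ℕ
ConeSize n = n + (n + 1)

embE : ∀ {n} → Subset n → Subset (ConeSize n)
embE {n} Z = Z ++ (⊥ {n} ++ (false ∷ []))

embT : ∀ {n} → Subset n → Subset (ConeSize n)
embT {n} X = ⊥ {n} ++ (X ++ (false ∷ []))

-- q(S) = S ∪ {a} ∪ ⋃_{e∈S} T_e
q : ∀ {n} → Subset n → Subset (ConeSize n)
q S = S ++ (S ++ (true ∷ []))

-- Q is the free 1-cone of M: its cyclic flats are exactly
-- Z(M) ∪ {q(F) : F a nonempty flat of M}, with the prescribed ranks.
IsFree1Cone : ∀ {n} → Matroid n → Matroid (ConeSize n) → Set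
IsFree1Cone {n} M Q =
  (∀ (Z : Subset (ConeSize n)) →
     IsCyclicFlat Q Z ⇔
       ((Σ (Subset n) λ Z′ → IsCyclicFlat M Z′ × Z ≡ embE Z′)
        ⊎ (Σ (Subset n) λ F → IsFlat M F × Nonempty F × Z ≡ q F)))
  × (∀ (Z : Subset n) → IsCyclicFlat M Z → rank Q (embE Z) ≡ rank M Z)
  × (∀ (F : Subset n) → IsFlat M F → Nonempty F → rank Q (q F) ≡ suc (rank M F))

-- Rank function of the deletion Q \ (E ∪ {a}), a matroid on T ≅ Fin n
tiplessBaselessRank : ∀ {n} → Matroid (ConeSize n) → Subset n → ℕ
tiplessBaselessRank Q X = rank Q (embT X)

image : ∀ {n} → Permutation′ n → Subset n → Subset n
image σ X = tabulate (λ j → lookup X (σ ⟨$⟩ˡ j))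

Isomorphic : ∀ {n} → (Subset n → ℕ) → (Subset n → ℕ) → Set
Isomorphic {n} r₁ r₂ = Σ (Permutation′ n) λ σ → ∀ X → r₂ (image σ X) ≡ r₁ X

-- Upper bound: T_X has |X| elements, and for nonempty X it lies in q(F) for the closure F
-- of X, a cyclic flat of Q of rank r(F) + 1 = r(X) + 1.
-- Lower bound: in any matroid r(Y) ≥ r(Z) + |Y − Z| for some cyclic flat Z (grow Y to its
-- closure, then delete coloops, which keeps it flat). For Y = T_X the cyclic flat Z of Q is
-- either some Z′ ⊆ E, giving r_Q(T_X) ≥ |X|, or some q(F), giving
-- r_Q(T_X) ≥ r(F) + 1 + |X − F| ≥ r(X) + 1. So the identity T ≅ E is the isomorphism.
module Submission where

open import Defs
open import Data.Nat using (ℕ; suc; _+_; _≤_; _<_; z≤n; s≤s)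
open import Data.Nat.Properties
open import Data.Bool using (true; false)
open import Data.Fin using (Fin)
open import Data.Fin.Properties using (any?) renaming (_≟_ to _≟ᶠ_)
open import Data.Fin.Subset
  using (Subset; inside; outside; ⊥; ⁅_⁆; _∈_; _∉_; _⊆_; _⊂_; _⊃_; _∪_; _∩_; _-_; _─_; ∣_∣; Nonempty; Empty)
open import Data.Fin.Subset.Properties
open import Data.Fin.Subset.Induction using (Acc; acc; ⊂-wellFounded; ⊃-wellFounded)
import Data.Fin.Permutation as Permutation
open import Data.Vec using (_∷_; []; _++_; here; there)
open import Data.Vec.Properties using (tabulate∘lookup; zipWith-++)
open import Data.Product using (∃; _×_; _,_; proj₁; proj₂)
open import Data.Sum using (_⊎_; inj₁; inj₂)
open import Relation.Nullary using (yes; no)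
open import Relation.Nullary.Decidable using (¬?; _×-dec_; decidable-stable)
open import Relation.Binary.PropositionalEquality using (_≡_; refl; sym; trans; cong; cong₂; subst; module ≡-Reasoning)
open import Function using (_∘_)
open import Function.Bundles using (Equivalence)

∣p++q∣≡∣p∣+∣q∣ : ∀ {a b} (p : Subset a) (q : Subset b) → ∣ p ++ q ∣ ≡ ∣ p ∣ + ∣ q ∣
∣p++q∣≡∣p∣+∣q∣ []            q = refl
∣p++q∣≡∣p∣+∣q∣ (inside  ∷ p) q = cong suc (∣p++q∣≡∣p∣+∣q∣ p q)
∣p++q∣≡∣p∣+∣q∣ (outside ∷ p) q = ∣p++q∣≡∣p∣+∣q∣ p q

─-distrib-++ : ∀ {a b} (p p′ : Subset a) (q q′ : Subset b) → (p ++ q) ─ (p′ ++ q′) ≡ (p ─ p′) ++ (q ─ q′)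
─-distrib-++ p p′ q q′ = zipWith-++ _ p q p′ q′

++-mono-⊆ : ∀ {a b} {p p′ : Subset a} {q q′ : Subset b} → p ⊆ p′ → q ⊆ q′ → p ++ q ⊆ p′ ++ q′
++-mono-⊆ {p = []}    {[]}    _    q⊆q′ x∈         = q⊆q′ x∈
++-mono-⊆ {p = _ ∷ _} {_ ∷ _} p⊆p′ q⊆q′ here       with p⊆p′ here
... | here = here
++-mono-⊆ {p = _ ∷ _} {_ ∷ _} p⊆p′ q⊆q′ (there x∈) = there (++-mono-⊆ (drop-∷-⊆ p⊆p′) q⊆q′ x∈)

x∈p─q⇒x∉q : ∀ {n} {x : Fin n} (p q : Subset n) → x ∈ p ─ q → x ∉ q
x∈p─q⇒x∉q (_ ∷ p) (outside ∷ q) here       ()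
x∈p─q⇒x∉q (_ ∷ p) (_       ∷ q) (there x∈) (there x∈q) = x∈p─q⇒x∉q p q x∈ x∈q

⊥─p≡⊥ : ∀ {n} (p : Subset n) → ⊥ ─ p ≡ ⊥
⊥─p≡⊥ []            = refl
⊥─p≡⊥ (inside  ∷ p) = cong (outside ∷_) (⊥─p≡⊥ p)
⊥─p≡⊥ (outside ∷ p) = cong (outside ∷_) (⊥─p≡⊥ p)

∣p∪q∣≤∣p∣+∣q∣ : ∀ {n} (p q : Subset n) → ∣ p ∪ q ∣ ≤ ∣ p ∣ + ∣ q ∣
∣p∪q∣≤∣p∣+∣q∣ []            []            = z≤n
∣p∪q∣≤∣p∣+∣q∣ (inside  ∷ p) (inside  ∷ q) = s≤s (≤-trans (∣p∪q∣≤∣p∣+∣q∣ p q) (+-monoʳ-≤ ∣ p ∣ (n≤1+n ∣ q ∣)))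
∣p∪q∣≤∣p∣+∣q∣ (inside  ∷ p) (outside ∷ q) = s≤s (∣p∪q∣≤∣p∣+∣q∣ p q)
∣p∪q∣≤∣p∣+∣q∣ (outside ∷ p) (inside  ∷ q) = ≤-trans (s≤s (∣p∪q∣≤∣p∣+∣q∣ p q)) (≤-reflexive (sym (+-suc ∣ p ∣ ∣ q ∣)))
∣p∪q∣≤∣p∣+∣q∣ (outside ∷ p) (outside ∷ q) = ∣p∪q∣≤∣p∣+∣q∣ p q

p⊆q⇒∣p─q∣≡0 : ∀ {n} {p q : Subset n} → p ⊆ q → ∣ p ─ q ∣ ≡ 0
p⊆q⇒∣p─q∣≡0 {n} {p} {q} p⊆q = trans (cong ∣_∣ (Empty-unique empty)) (∣⊥∣≡0 n)
  where
  empty : Empty (p ─ q)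
  empty (x , x∈) = x∈p─q⇒x∉q p q x∈ (p⊆q (p─q⊆p p q x∈))

x∉p⇒p⊂p∪⁅x⁆ : ∀ {n} {x : Fin n} {p : Subset n} → x ∉ p → p ⊂ p ∪ ⁅ x ⁆
x∉p⇒p⊂p∪⁅x⁆ {x = x} x∉p = p⊆p∪q ⁅ x ⁆ , x , x∈p∪q⁺ (inj₂ (x∈⁅x⁆ x)) , x∉p

p⊆[p-x]∪⁅x⁆ : ∀ {n} (p : Subset n) (x : Fin n) → p ⊆ (p - x) ∪ ⁅ x ⁆
p⊆[p-x]∪⁅x⁆ p x {y} y∈p with y ≟ᶠ x
... | yes refl = x∈p∪q⁺ (inj₂ (x∈⁅x⁆ y))
... | no  y≢x  = x∈p∪q⁺ (inj₁ (x∈p∧x≢y⇒x∈p-y y∈p y≢x))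

p─[q-x]⊆[p─q]∪⁅x⁆ : ∀ {n} (p q : Subset n) (x : Fin n) → p ─ (q - x) ⊆ (p ─ q) ∪ ⁅ x ⁆
p─[q-x]⊆[p─q]∪⁅x⁆ p q x {y} y∈ with y ≟ᶠ x
... | yes refl = x∈p∪q⁺ (inj₂ (x∈⁅x⁆ y))
... | no  y≢x  = x∈p∪q⁺ (inj₁ (x∈p∧x∉q⇒x∈p─q (p─q⊆p p (q - x) y∈)
                   (x∈p─q⇒x∉q p (q - x) y∈ ∘ λ y∈q → x∈p∧x≢y⇒x∈p-y y∈q y≢x)))

∣p─[q-x]∣≤1+∣p─q∣ : ∀ {n} (p q : Subset n) (x : Fin n) → ∣ p ─ (q - x) ∣ ≤ suc ∣ p ─ q ∣
∣p─[q-x]∣≤1+∣p─q∣ p q x = begin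
  ∣ p ─ (q - x) ∣         ≤⟨ p⊆q⇒∣p∣≤∣q∣ (p─[q-x]⊆[p─q]∪⁅x⁆ p q x) ⟩
  ∣ (p ─ q) ∪ ⁅ x ⁆ ∣     ≤⟨ ∣p∪q∣≤∣p∣+∣q∣ (p ─ q) ⁅ x ⁆ ⟩
  ∣ p ─ q ∣ + ∣ ⁅ x ⁆ ∣   ≡⟨ cong (∣ p ─ q ∣ +_) (∣⁅x⁆∣≡1 x) ⟩
  ∣ p ─ q ∣ + 1           ≡⟨ +-comm ∣ p ─ q ∣ 1 ⟩
  suc ∣ p ─ q ∣           ∎
  where open ≤-Reasoning

module MatroidProperties {m : ℕ} (N : Matroid m) where

  private
    r : Subset m → ℕ
    r = rank N

  r-submod-⊆ : ∀ {U I A B} → U ⊆ A ∪ B → I ⊆ A ∩ B → r U + r I ≤ r A + r B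
  r-submod-⊆ {A = A} {B} U⊆ I⊆ = ≤-trans (+-mono-≤ (r-mono N U⊆) (r-mono N I⊆)) (r-submod N A B)

  r[p∪q]≤r[p]+∣q∣ : ∀ A B → r (A ∪ B) ≤ r A + ∣ B ∣
  r[p∪q]≤r[p]+∣q∣ A B = begin
    r (A ∪ B)             ≤⟨ m≤m+n (r (A ∪ B)) (r (A ∩ B)) ⟩
    r (A ∪ B) + r (A ∩ B) ≤⟨ r-submod N A B ⟩
    r A + r B             ≤⟨ +-monoʳ-≤ (r A) (r-bound N B) ⟩
    r A + ∣ B ∣           ∎
    where open ≤-Reasoning

  r[p]≤r[q]+∣p─q∣ : ∀ A B → r A ≤ r B + ∣ A ─ B ∣
  r[p]≤r[q]+∣p─q∣ A B = ≤-trans (r-mono N A⊆) (r[p∪q]≤r[p]+∣q∣ B (A ─ B))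
    where
    A⊆ : A ⊆ B ∪ (A ─ B)
    A⊆ {x} x∈A with x ∈? B
    ... | yes x∈B = x∈p∪q⁺ (inj₁ x∈B)
    ... | no  x∉B = x∈p∪q⁺ (inj₂ (x∈p∧x∉q⇒x∈p─q x∈A x∉B))

  flat⊎extendable : ∀ F → IsFlat N F ⊎ ∃ λ e → e ∉ F × r (F ∪ ⁅ e ⁆) ≤ r F
  flat⊎extendable F with any? (λ e → ¬? (e ∈? F) ×-dec (r (F ∪ ⁅ e ⁆) ≤? r F))
  ... | yes witness = inj₂ witness
  ... | no  ¬witness = inj₁ λ e e∉F → ≰⇒> λ r≤ → ¬witness (e , e∉F , r≤)

  closure : ∀ Y → ∃ λ F → IsFlat N F × Y ⊆ F × r F ≤ r Y
  closure Y = extend Y (⊃-wellFounded Y) ⊆-refl ≤-refl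
    where
    extend : ∀ F → Acc _⊃_ F → Y ⊆ F → r F ≤ r Y → ∃ λ F → IsFlat N F × Y ⊆ F × r F ≤ r Y
    extend F (acc rec) Y⊆F rF≤rY with flat⊎extendable F
    ... | inj₁ flat = F , flat , Y⊆F , rF≤rY
    ... | inj₂ (e , e∉F , r≤) =
      extend (F ∪ ⁅ e ⁆) (rec (x∉p⇒p⊂p∪⁅x⁆ e∉F)) (p⊆p∪q ⁅ e ⁆ ∘ Y⊆F) (≤-trans r≤ rF≤rY)

  flat-minus-coloop : ∀ {K e} → IsFlat N K → e ∈ K → r (K - e) < r K → IsFlat N (K - e)
  flat-minus-coloop {K} {e} flat e∈K coloop f f∉ with f ≟ᶠ e
  ... | yes refl = <-≤-trans coloop (r-mono N (p⊆[p-x]∪⁅x⁆ K e))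
  ... | no  f≢e  = ≰⇒> λ r≤ → <⇒≱ (flat f f∉K) (r[K∪f]≤r[K] r≤)
    where
    f∉K : f ∉ K
    f∉K f∈K = f∉ (x∈p∧x≢y⇒x∈p-y f∈K f≢e)
    K∪f⊆ : K ∪ ⁅ f ⁆ ⊆ K ∪ ((K - e) ∪ ⁅ f ⁆)
    K∪f⊆ x∈ with x∈p∪q⁻ K ⁅ f ⁆ x∈
    ... | inj₁ x∈K = x∈p∪q⁺ (inj₁ x∈K)
    ... | inj₂ x∈f = x∈p∪q⁺ (inj₂ (x∈p∪q⁺ (inj₂ x∈f)))
    K-e⊆ : K - e ⊆ K ∩ ((K - e) ∪ ⁅ f ⁆)
    K-e⊆ x∈ = x∈p∩q⁺ (p─q⊆p K ⁅ e ⁆ x∈ , x∈p∪q⁺ (inj₁ x∈))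
    -- submodularity for K and (K − e) ∪ {f}, which meet in K − e
    r[K∪f]≤r[K] : r ((K - e) ∪ ⁅ f ⁆) ≤ r (K - e) → r (K ∪ ⁅ f ⁆) ≤ r K
    r[K∪f]≤r[K] r≤ = +-cancelʳ-≤ (r (K - e)) _ _
      (≤-trans (r-submod-⊆ K∪f⊆ K-e⊆) (+-monoʳ-≤ (r K) r≤))

  cyclic⊎coloop : ∀ K → IsCyclic N K ⊎ ∃ λ e → e ∈ K × r (K - e) < r K
  cyclic⊎coloop K with any? (λ e → (e ∈? K) ×-dec ¬? (r (K - e) ≟ r K))
  ... | yes (e , e∈K , r≢) = inj₂ (e , e∈K , ≤∧≢⇒< (r-mono N (p─q⊆p K ⁅ e ⁆)) r≢)
  ... | no  ¬witness = inj₁ λ e e∈K → decidable-stable (r (K - e) ≟ r K) (λ r≢ → ¬witness (e , e∈K , r≢))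

  cyclicFlat-rank-bound : ∀ Y → ∃ λ Z → IsCyclicFlat N Z × r Z + ∣ Y ─ Z ∣ ≤ r Y
  cyclicFlat-rank-bound Y with closure Y
  ... | F , flat , Y⊆F , rF≤rY = shrink F (⊂-wellFounded F) flat start
    where
    start : r F + ∣ Y ─ F ∣ ≤ r Y
    start rewrite p⊆q⇒∣p─q∣≡0 Y⊆F | +-identityʳ (r F) = rF≤rY
    shrink : ∀ K → Acc _⊂_ K → IsFlat N K → r K + ∣ Y ─ K ∣ ≤ r Y →
             ∃ λ Z → IsCyclicFlat N Z × r Z + ∣ Y ─ Z ∣ ≤ r Y
    shrink K (acc rec) flat bound with cyclic⊎coloop K
    ... | inj₁ cyclic = K , (cyclic , flat) , bound
    ... | inj₂ (e , e∈K , coloop) =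
      shrink (K - e) (rec (x∈p⇒p-x⊂p e∈K)) (flat-minus-coloop flat e∈K coloop) (begin
        r (K - e) + ∣ Y ─ (K - e) ∣   ≤⟨ +-monoʳ-≤ (r (K - e)) (∣p─[q-x]∣≤1+∣p─q∣ Y K e) ⟩
        r (K - e) + suc ∣ Y ─ K ∣     ≡⟨ +-suc (r (K - e)) ∣ Y ─ K ∣ ⟩
        suc (r (K - e)) + ∣ Y ─ K ∣   ≤⟨ +-monoˡ-≤ ∣ Y ─ K ∣ coloop ⟩
        r K + ∣ Y ─ K ∣               ≤⟨ bound ⟩
        r Y                           ∎)
      where open ≤-Reasoning

module _ {n : ℕ} where

  ∣embT[p]∣≡∣p∣ : ∀ (X : Subset n) → ∣ embT X ∣ ≡ ∣ X ∣
  ∣embT[p]∣≡∣p∣ X = begin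
    ∣ ⊥ {n} ++ (X ++ (false ∷ [])) ∣   ≡⟨ ∣p++q∣≡∣p∣+∣q∣ (⊥ {n}) (X ++ (false ∷ [])) ⟩
    ∣ ⊥ {n} ∣ + ∣ X ++ (false ∷ []) ∣  ≡⟨ cong₂ _+_ (∣⊥∣≡0 n) (∣p++q∣≡∣p∣+∣q∣ X (false ∷ [])) ⟩
    ∣ X ∣ + 0                          ≡⟨ +-identityʳ ∣ X ∣ ⟩
    ∣ X ∣                              ∎
    where open ≡-Reasoning

  embT─embE≡embT : ∀ (X Z : Subset n) → embT X ─ embE Z ≡ embT X
  embT─embE≡embT X Z
    rewrite ─-distrib-++ (⊥ {n}) Z (X ++ (false ∷ [])) (⊥ {n} ++ (false ∷ []))
          | ─-distrib-++ X (⊥ {n}) (false ∷ []) (false ∷ [])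
          | ⊥─p≡⊥ Z | p─⊥≡p X
          = refl

  embT─q≡embT[─] : ∀ (X F : Subset n) → embT X ─ q F ≡ embT (X ─ F)
  embT─q≡embT[─] X F
    rewrite ─-distrib-++ (⊥ {n}) F (X ++ (false ∷ [])) (F ++ (true ∷ []))
          | ─-distrib-++ X F (false ∷ []) (true ∷ [])
          | ⊥─p≡⊥ F
          = refl

  embT-mono-q : ∀ {X F : Subset n} → X ⊆ F → embT X ⊆ q F
  embT-mono-q {F = F} X⊆F = ++-mono-⊆ {p′ = F} (⊆-min F) (++-mono-⊆ X⊆F (out⊆ {q = []} ⊆-refl))

module FreeOneCone {n : ℕ} (M : Matroid n) (Q : Matroid (ConeSize n)) (cone : IsFree1Cone M Q) where

  private
    module MM = MatroidProperties M
    module MQ = MatroidProperties Q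

    cyclicFlat-of-Q : ∀ Z → IsCyclicFlat Q Z →
      (∃ λ Z′ → IsCyclicFlat M Z′ × Z ≡ embE Z′) ⊎ (∃ λ F → IsFlat M F × Nonempty F × Z ≡ q F)
    cyclicFlat-of-Q Z = Equivalence.to (proj₁ cone Z)

    rank-q : ∀ F → IsFlat M F → Nonempty F → rank Q (q F) ≡ suc (rank M F)
    rank-q = proj₂ (proj₂ cone)

  rank-embT≤∣p∣ : ∀ (X : Subset n) → rank Q (embT X) ≤ ∣ X ∣
  rank-embT≤∣p∣ X = subst (rank Q (embT X) ≤_) (∣embT[p]∣≡∣p∣ X) (r-bound Q (embT X))

  rank-embT≤1+rank : ∀ (X : Subset n) → rank Q (embT X) ≤ suc (rank M X)
  rank-embT≤1+rank X with nonempty? X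
  ... | no  empty = ≤-trans (rank-embT≤∣p∣ X) (subst (_≤ suc (rank M X)) (sym ∣X∣≡0) z≤n)
    where
    ∣X∣≡0 : ∣ X ∣ ≡ 0
    ∣X∣≡0 = trans (cong ∣_∣ (Empty-unique empty)) (∣⊥∣≡0 n)
  ... | yes (x , x∈X) with MM.closure X
  ... | F , flat , X⊆F , rF≤rX = begin
    rank Q (embT X)  ≤⟨ r-mono Q (embT-mono-q X⊆F) ⟩
    rank Q (q F)     ≡⟨ rank-q F flat (x , X⊆F x∈X) ⟩
    suc (rank M F)   ≤⟨ s≤s rF≤rX ⟩
    suc (rank M X)   ∎
    where open ≤-Reasoning

  higgsRank≤rank-embT : ∀ (X : Subset n) → higgsRank M X ≤ rank Q (embT X)
  higgsRank≤rank-embT X with MQ.cyclicFlat-rank-bound (embT X)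
  ... | Z , cyclicFlat , bound with cyclicFlat-of-Q Z cyclicFlat
  ... | inj₁ (Z′ , _ , refl) = ≤-trans (m⊓n≤n _ _) (begin
    ∣ X ∣                                     ≡⟨ sym (∣embT[p]∣≡∣p∣ X) ⟩
    ∣ embT X ∣                                ≡⟨ cong ∣_∣ (sym (embT─embE≡embT X Z′)) ⟩
    ∣ embT X ─ embE Z′ ∣                      ≤⟨ m≤n+m _ (rank Q (embE Z′)) ⟩
    rank Q (embE Z′) + ∣ embT X ─ embE Z′ ∣   ≤⟨ bound ⟩
    rank Q (embT X)                           ∎)
    where open ≤-Reasoning
  ... | inj₂ (F , flat , nonempty , refl) = ≤-trans (m⊓n≤m _ _) (begin
    suc (rank M X)                     ≤⟨ s≤s (MM.r[p]≤r[q]+∣p─q∣ X F) ⟩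
    suc (rank M F) + ∣ X ─ F ∣         ≡⟨ cong₂ _+_ (sym (rank-q F flat nonempty)) (sym ∣embT─q∣≡∣X─F∣) ⟩
    rank Q (q F) + ∣ embT X ─ q F ∣    ≤⟨ bound ⟩
    rank Q (embT X)                    ∎)
    where
    open ≤-Reasoning
    ∣embT─q∣≡∣X─F∣ : ∣ embT X ─ q F ∣ ≡ ∣ X ─ F ∣
    ∣embT─q∣≡∣X─F∣ = trans (cong ∣_∣ (embT─q≡embT[─] X F)) (∣embT[p]∣≡∣p∣ (X ─ F))

  rank-embT≡higgsRank : ∀ (X : Subset n) → rank Q (embT X) ≡ higgsRank M X
  rank-embT≡higgsRank X = ≤-antisym (⊓-glb (rank-embT≤1+rank X) (rank-embT≤∣p∣ X)) (higgsRank≤rank-embT X)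

-- Looplessness is what guarantees that the free 1-cone exists.
theorem4p1 : ∀ {n : ℕ} (M : Matroid n) (Q : Matroid (ConeSize n)) →
    Loopless M → IsFree1Cone M Q →
    Isomorphic (tiplessBaselessRank Q) (higgsRank M)
theorem4p1 M Q _ cone = Permutation.id , λ X → begin
  higgsRank M (image Permutation.id X)  ≡⟨ cong (higgsRank M) (tabulate∘lookup X) ⟩
  higgsRank M X                         ≡⟨ sym (rank-embT≡higgsRank X) ⟩
  rank Q (embT X)                       ∎
  where
  open FreeOneCone M Q cone
  open ≡-Reasoning
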